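{- As formal power series in $x$ with coefficients in $\mathbb{Z}[q]$, \[ \sum_{r \geq 1} \mathscr{P}_{B_r}^{NH}(q)x^r=\frac{qx+(-2q-q^2)x^2+(q+q^2)x^3}{1-(2+2q+q^2)x+(1+2q+q^2+q^3)x^2}. \]
   Context: Type $B_n$ ($n\ge1$): with simple roots $\alpha_1,\dots,\alpha_n$, the positive roots are the nonhooked roots $\alpha_i+\cdots+\alpha_j$ ($1\le i\le j\le n$) and the hooked roots $\alpha_i+\cdots+\alpha_{j-1}+2\alpha_j+\cdots+2\alpha_n$ ($1\le i<j\le n$); the highest root is $\tilde\alpha=\alpha_1+2\alpha_2+\cdots+2\alpha_n$ (equal to $\alpha_1$ if $n=1$). A partition of $\tilde\alpha$ with $k$ parts is a multiset of $k$ positive roots (repetitions allowed) summing to $\tilde\alpha$. $\mathscr{P}^{NH}_{B_n}(q)=\sum_kd_kq^k$ where $d_k$ is the number of partitions of $\tilde\alpha$ with exactly $k$ parts none of which is a hooked root. -}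

module Defs where

open import Data.Nat using (ℕ; zero; suc; _+_; _∸_)
open import Data.Integer using (ℤ; +_; -[1+_]) renaming (_+_ to _+ℤ_; _*_ to _*ℤ_)
open import Data.List using (List; []; _∷_; _++_; map; length; filter; replicate; zipWith; foldr; upTo; concatMap)
open import Data.List.Properties using (≡-dec)
import Data.Nat as ℕ
open import Relation.Binary.PropositionalEquality using (_≡_)
open import Relation.Nullary using (Dec)
open import Data.Bool using (if_then_else_; _∧_)

-- Roots of type B_n, written in coordinates w.r.t. the simple roots
-- α₁,…,αₙ: a root is a list of n natural numbers (its coefficients).

interval : ℕ → ℕ → ℕ → List ℕ
interval n i j = map (λ p → indicator p) (map suc (upTo n))
  where
  indicator : ℕ → ℕ
  indicator p = if (i ℕ.≤ᵇ p) ∧ (p ℕ.≤ᵇ j) then 1 else 0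

-- The nonhooked positive roots of B_n: αᵢ + ⋯ + αⱼ for 1 ≤ i ≤ j ≤ n
-- (pairwise distinct, each listed once).
nonhooked : ℕ → List (List ℕ)
nonhooked n =
  concatMap (λ i → map (λ j → interval n i j) (map (λ t → i + t) (upTo (suc n ∸ i))))
            (map suc (upTo n))

highest : ℕ → List ℕ
highest n = 1 ∷ replicate (n ∸ 1) 2

sumRoots : ℕ → List (List ℕ) → List ℕ
sumRoots n = foldr (zipWith _+_) (replicate n 0)

-- All multisets of exactly k elements drawn from the list xs, each multiset
-- represented once, as a list that is "nondecreasing" w.r.t. the order of xs.
multisets : {A : Set} → ℕ → List A → List (List A)
multisets zero    xs       = [] ∷ []
multisets (suc k) []       = []
multisets (suc k) (x ∷ xs) = map (x ∷_) (multisets k (x ∷ xs)) ++ multisets (suc k) xs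

-- d n k = number of partitions of the highest root of B_n with exactly k parts,
-- none of which is a hooked root (i.e. multisets of k nonhooked roots summing to α̃).
dNH : ℕ → ℕ → ℕ
dNH n k = length (filter (λ p → ≡-dec ℕ._≟_ (sumRoots n p) (highest n)) (multisets k (nonhooked n)))

-- Formal power series in x with coefficients in ℤ[q], represented by
-- their coefficient function:  F r k = coefficient of x^r q^k.

Series : Set
Series = ℕ → ℕ → ℤ

sumTo : ℕ → (ℕ → ℤ) → ℤ
sumTo zero    f = f 0
sumTo (suc r) f = sumTo r f +ℤ f (suc r)

_⊛_ : Series → Series → Series
(F ⊛ G) r k = sumTo r (λ i → sumTo k (λ j → F i j *ℤ G (r ∸ i) (k ∸ j)))

-- A polynomial in x and q given by its coefficient lists:
-- the r-th list holds the coefficients (in q^0, q^1, …) of x^r.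
nth : {A : Set} → A → List A → ℕ → A
nth d []       _       = d
nth d (a ∷ as) zero    = a
nth d (a ∷ as) (suc i) = nth d as i

poly : List (List ℤ) → Series
poly cs r k = nth (+ 0) (nth [] cs r) k

-- Σ_{r ≥ 1} P^{NH}_{B_r}(q) x^r, where P^{NH}_{B_r}(q) = Σ_k dNH r k q^k.
PNHSeries : Series
PNHSeries zero    k = + 0
PNHSeries (suc r) k = + dNH (suc r) k

numerator : Series
numerator = poly ( []
                 ∷ (+ 0 ∷ + 1 ∷ [])
                 ∷ (+ 0 ∷ -[1+ 1 ] ∷ -[1+ 0 ] ∷ [])
                 ∷ (+ 0 ∷ + 1 ∷ + 1 ∷ [])
                 ∷ [])

denominator : Series
denominator = poly ( (+ 1 ∷ [])
                   ∷ (-[1+ 1 ] ∷ -[1+ 1 ] ∷ -[1+ 0 ] ∷ [])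
                   ∷ (+ 1 ∷ + 2 ∷ + 1 ∷ + 1 ∷ [])
                   ∷ [])

module Submission where

-- Write the highest root of B_{c+1} as the vector 1 2^c and let A_c be its partition
-- series (in q, graded by the number of parts); P^NH_{B_{c+1}} = A_c.  Counting partitions
-- of targets 1^b 2^c by looking at the roots that cover the first coordinate (there are
-- no others, and each is α₁ + ⋯ + αⱼ) gives, with E_c the series of 2^c and T_c an
-- auxiliary series, the relations
--   A_{c+1} = q (E_{c+1} + T_c),   T_{c+1} = A_{c+1} + (1+q) T_c,   E_{c+2} = E_{c+1} + q A_{c+1}.
-- Eliminating E and T yields A_{c+3} − (2+2q+q²) A_{c+2} + (1+2q+q²+q³) A_{c+1} = 0, which is
-- the vanishing of the x^{c+4}-coefficient; the coefficients of x⁰, …, x³ are finite checks.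

open import Defs
open import Data.Nat using (ℕ; suc)
open import Relation.Binary.PropositionalEquality using (_≡_)

-- Counting multisets of roots.  `count k xs t` enumerates the multisets of k entries
-- of xs summing to t by deciding how often the first entry is used; for vectors of a
-- common length it agrees with the filter-count through which dNH is defined.
module MultisetCount where

  open import Data.Nat using (ℕ; zero; suc; _+_; _∸_; _≤_; _≤ᵇ_; _≟_)
  open import Data.Nat.Properties
    using (m+[n∸m]≡n; m+n∸m≡n; m≤m+n; suc-injective; ≤-pred; ≤ᵇ⇒≤; ≤⇒≤ᵇ; ≤-trans; ≤-reflexive; m⊓n≤n)
  open import Data.Bool using (Bool; true; false; if_then_else_; _∧_)
  open import Data.Bool.Properties using (T-≡)
  open import Data.List using (List; []; _∷_; _++_; map; length; filter; replicate; zipWith)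
  open import Data.List.Properties
    using (≡-dec; filter-++; length-++; length-map; filter-≐; filter-none; filter-accept; filter-reject;
           length-zipWith; length-replicate)
  open import Data.List.Relation.Unary.All as All using (All; _∷_)
  open import Data.Product using (_×_; _,_; proj₁; proj₂)
  open import Function using (_∘_)
  open import Function.Bundles using (Equivalence)
  open import Relation.Nullary using (does; contradiction)
  open import Relation.Unary using (Decidable)
  open import Relation.Binary.PropositionalEquality
  open ≡-Reasoning

  _≼_ : List ℕ → List ℕ → Bool
  []       ≼ _        = true
  (_ ∷ _)  ≼ []       = false
  (x ∷ xs) ≼ (t ∷ ts) = (x ≤ᵇ t) ∧ (xs ≼ ts)

  _⊝_ : List ℕ → List ℕ → List ℕ
  []       ⊝ _        = []
  (t ∷ ts) ⊝ []       = t ∷ ts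
  (t ∷ ts) ⊝ (x ∷ xs) = (t ∸ x) ∷ (ts ⊝ xs)

  isZero : List ℕ → Bool
  isZero []          = true
  isZero (zero ∷ ts) = isZero ts
  isZero (suc _ ∷ _) = false

  count : ℕ → List (List ℕ) → List ℕ → ℕ
  count zero    _        t = if isZero t then 1 else 0
  count (suc k) []       t = 0
  count (suc k) (x ∷ xs) t = (if x ≼ t then count k (x ∷ xs) (t ⊝ x) else 0) + count (suc k) xs t

  length-⊝ : ∀ t x → length (t ⊝ x) ≡ length t
  length-⊝ []       _        = refl
  length-⊝ (t ∷ ts) []       = refl
  length-⊝ (t ∷ ts) (x ∷ xs) = cong suc (length-⊝ ts xs)

  +-⊝-inverse : ∀ x t → x ≼ t ≡ true → length x ≡ length t → zipWith _+_ x (t ⊝ x) ≡ t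
  +-⊝-inverse []       []       _    _   = refl
  +-⊝-inverse (x ∷ xs) (t ∷ ts) fits len with x ≤ᵇ t in x≤t
  ... | true = cong₂ _∷_ (m+[n∸m]≡n (≤ᵇ⇒≤ x t (Equivalence.from T-≡ x≤t)))
                         (+-⊝-inverse xs ts fits (suc-injective len))

  +-⊝-split : ∀ x s t → length x ≡ length t → length s ≤ length t →
              zipWith _+_ x s ≡ t → (x ≼ t ≡ true) × (s ≡ t ⊝ x)
  +-⊝-split []       []       []                _   _   _    = refl , refl
  +-⊝-split (x ∷ xs) (s ∷ ss) (.(x + s) ∷ ts) len len≤ refl
    with +-⊝-split xs ss ts (suc-injective len) (≤-pred len≤) refl
  ... | fits , rest rewrite Equivalence.to T-≡ (≤⇒≤ᵇ (m≤m+n x s)) | fits =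
    refl , cong₂ _∷_ (sym (m+n∸m≡n x s)) rest

  length-sumRoots : ∀ n ps → length (sumRoots n ps) ≤ n
  length-sumRoots n []       = ≤-reflexive (length-replicate n)
  length-sumRoots n (p ∷ ps) rewrite length-zipWith _+_ p (sumRoots n ps) =
    ≤-trans (m⊓n≤n (length p) _) (length-sumRoots n ps)

  isZero-sound : ∀ n t → length t ≡ n → isZero t ≡ true → replicate n 0 ≡ t
  isZero-sound zero    []         _   _ = refl
  isZero-sound (suc n) (zero ∷ t) len z = cong (0 ∷_) (isZero-sound n t (suc-injective len) z)

  isZero-complete : ∀ n t → replicate n 0 ≡ t → isZero t ≡ true
  isZero-complete zero    .[]                refl = refl
  isZero-complete (suc n) .(0 ∷ replicate n 0) refl = isZero-complete n (replicate n 0) refl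

  sumsTo? : (n : ℕ) (t : List ℕ) → Decidable (λ p → sumRoots n p ≡ t)
  sumsTo? n t p = ≡-dec _≟_ (sumRoots n p) t

  module _ (n : ℕ) {x t : List ℕ} (|x| : length x ≡ n) (|t| : length t ≡ n) where

    |x|≡|t| : length x ≡ length t
    |x|≡|t| = trans |x| (sym |t|)

    sum-cons-split : ∀ p → sumRoots n (x ∷ p) ≡ t → (x ≼ t ≡ true) × (sumRoots n p ≡ t ⊝ x)
    sum-cons-split p = +-⊝-split x (sumRoots n p) t |x|≡|t|
                         (≤-trans (length-sumRoots n p) (≤-reflexive (sym |t|)))

    sum-cons-join : x ≼ t ≡ true → ∀ p → sumRoots n p ≡ t ⊝ x → sumRoots n (x ∷ p) ≡ t
    sum-cons-join fits p eq = trans (cong (zipWith _+_ x) eq) (+-⊝-inverse x t fits |x|≡|t|)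

  filter-map : ∀ {A B : Set} {P : B → Set} (P? : Decidable P) (f : A → B) xs →
               filter P? (map f xs) ≡ map f (filter (λ y → P? (f y)) xs)
  filter-map P? f []       = refl
  filter-map P? f (x ∷ xs) with does (P? (f x))
  ... | true  = cong (f x ∷_) (filter-map P? f xs)
  ... | false = filter-map P? f xs

  count-correct : ∀ n k xs t → All (λ x → length x ≡ n) xs → length t ≡ n →
                  length (filter (sumsTo? n t) (multisets k xs)) ≡ count k xs t
  count-correct n zero xs t _ |t| with isZero t in z
  ... | true  = cong length (filter-accept (sumsTo? n t) {x = []} {xs = []} (isZero-sound n t |t| z))
  ... | false = cong length (filter-reject (sumsTo? n t) {x = []} {xs = []}
                  (λ eq → contradiction (trans (sym (isZero-complete n t eq)) z) λ ()))
  count-correct n (suc k) []       t _                  _   = refl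
  count-correct n (suc k) (x ∷ xs) t all@(|x| ∷ |xs|) |t| = begin
      length (filter P (map (x ∷_) M ++ M'))
    ≡⟨ cong length (filter-++ P (map (x ∷_) M) M') ⟩
      length (filter P (map (x ∷_) M) ++ filter P M')
    ≡⟨ length-++ (filter P (map (x ∷_) M)) ⟩
      length (filter P (map (x ∷_) M)) + length (filter P M')
    ≡⟨ cong₂ _+_ (trans (cong length (filter-map P (x ∷_) M)) (length-map (x ∷_) (filter (λ p → P (x ∷ p)) M)))
                 (count-correct n (suc k) xs t |xs| |t|) ⟩
      length (filter (λ p → P (x ∷ p)) M) + count (suc k) xs t
    ≡⟨ cong (_+ count (suc k) xs t) with-x ⟩
      count (suc k) (x ∷ xs) t ∎
    where
    P  = sumsTo? n t
    M  = multisets k (x ∷ xs)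
    M' = multisets (suc k) xs

    with-x : length (filter (λ p → P (x ∷ p)) M) ≡ (if x ≼ t then count k (x ∷ xs) (t ⊝ x) else 0)
    with-x with x ≼ t in fits
    ... | true  = begin
        length (filter (λ p → P (x ∷ p)) M)
      ≡⟨ cong length (filter-≐ (λ p → P (x ∷ p)) (sumsTo? n (t ⊝ x))
           ((λ {p} → proj₂ ∘ sum-cons-split n |x| |t| p) , λ {p} → sum-cons-join n |x| |t| fits p) M) ⟩
        length (filter (sumsTo? n (t ⊝ x)) M)
      ≡⟨ count-correct n k (x ∷ xs) (t ⊝ x) all (trans (length-⊝ t x) |t|) ⟩
        count k (x ∷ xs) (t ⊝ x) ∎
    ... | false = cong length (filter-none (λ p → P (x ∷ p)) (All.universal
                    (λ p eq → contradiction (trans (sym (proj₁ (sum-cons-split n |x| |t| p eq))) fits) λ ()) M))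

module NonhookedRoots where

  open import Data.Nat using (ℕ; zero; suc; _+_; _∸_; _≤ᵇ_)
  open import Data.Bool using (if_then_else_; _∧_)
  open import Data.List using (List; []; _∷_; _++_; map; concat; length; replicate; applyUpTo; upTo)
  open import Data.List.Properties using (map-upTo; map-applyUpTo; map-cong; concat-map; length-replicate)
  open import Data.List.Relation.Unary.All as All using (All; []; _∷_)
  open import Data.List.Relation.Unary.All.Properties using (map⁺; ++⁺)
  open import Function using (_∘_)
  open import Relation.Binary.PropositionalEquality
  open ≡-Reasoning

  initials : ℕ → List (List ℕ)
  initials zero    = [] ∷ []
  initials (suc m) = replicate (suc m) 0 ∷ map (1 ∷_) (initials m)

  intervals : ℕ → List (List ℕ)
  intervals zero    = []
  intervals (suc m) = map (1 ∷_) (initials m) ++ map (0 ∷_) (intervals m)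

  initials-length : ∀ m → All (λ x → length x ≡ m) (initials m)
  initials-length zero    = refl ∷ []
  initials-length (suc m) = length-replicate (suc m) ∷ map⁺ (All.map (cong suc) (initials-length m))

  intervals-length : ∀ m → All (λ x → length x ≡ m) (intervals m)
  intervals-length zero    = []
  intervals-length (suc m) = ++⁺ (map⁺ (All.map (cong suc) (initials-length m)))
                                 (map⁺ (All.map (cong suc) (intervals-length m)))

  applyUpTo-cong : ∀ {A : Set} {f g : ℕ → A} → (∀ p → f p ≡ g p) → ∀ n → applyUpTo f n ≡ applyUpTo g n
  applyUpTo-cong {f = f} {g} f≗g n =
    trans (sym (map-upTo f n)) (trans (map-cong f≗g (upTo n)) (map-upTo g n))

  member : ℕ → ℕ → ℕ → ℕ
  member i j p = if (i ≤ᵇ p) ∧ (p ≤ᵇ j) then 1 else 0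

  ≤ᵇ-suc : ∀ a b → (suc a ≤ᵇ suc b) ≡ (a ≤ᵇ b)
  ≤ᵇ-suc zero    b = refl
  ≤ᵇ-suc (suc a) b = refl

  member-suc : ∀ i j p → member (suc i) (suc j) (suc p) ≡ member i j p
  member-suc i j p rewrite ≤ᵇ-suc i p | ≤ᵇ-suc p j = refl

  interval-tabulate : ∀ n i j → interval n i j ≡ applyUpTo (member i j ∘ suc) n
  interval-tabulate n i j = trans (cong (map _) (map-upTo suc n)) (map-applyUpTo suc _ n)

  interval-suc : ∀ n i j → interval (suc n) (suc i) (suc j) ≡ member i j 0 ∷ interval n i j
  interval-suc n i j = begin
    interval (suc n) (suc i) (suc j)                  ≡⟨ interval-tabulate (suc n) (suc i) (suc j) ⟩
    applyUpTo (member (suc i) (suc j) ∘ suc) (suc n)  ≡⟨ applyUpTo-cong (member-suc i j) (suc n) ⟩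
    applyUpTo (member i j) (suc n)                    ≡⟨ cong (member i j 0 ∷_) (sym (interval-tabulate n i j)) ⟩
    member i j 0 ∷ interval n i j                     ∎

  -- Coordinates are numbered from 1, so a lower end 0 acts as a lower end 1.
  interval-from-0 : ∀ n j → interval n 0 j ≡ interval n 1 j
  interval-from-0 n j = trans (interval-tabulate n 0 j) (sym (interval-tabulate n 1 j))

  applyUpTo-zero : ∀ n → applyUpTo (λ _ → 0) n ≡ replicate n 0
  applyUpTo-zero zero    = refl
  applyUpTo-zero (suc n) = cong (0 ∷_) (applyUpTo-zero n)

  initials-tabulate : ∀ m → applyUpTo (interval m 0) (suc m) ≡ initials m
  initials-tabulate zero    = refl
  initials-tabulate (suc m) = cong₂ _∷_ (trans (interval-tabulate (suc m) 0 0) (applyUpTo-zero (suc m))) (begin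
    applyUpTo (interval (suc m) 0 ∘ suc) (suc m)  ≡⟨ applyUpTo-cong (λ t → trans (interval-from-0 (suc m) (suc t))
                                                                                 (interval-suc m 0 t)) (suc m) ⟩
    applyUpTo ((1 ∷_) ∘ interval m 0) (suc m)     ≡⟨ sym (map-applyUpTo (interval m 0) (1 ∷_) (suc m)) ⟩
    map (1 ∷_) (applyUpTo (interval m 0) (suc m)) ≡⟨ cong (map (1 ∷_)) (initials-tabulate m) ⟩
    map (1 ∷_) (initials m)                       ∎)

  startingAt : ℕ → ℕ → List (List ℕ)
  startingAt n i = applyUpTo (λ t → interval n i (i + t)) (suc n ∸ i)

  nonhooked-blocks : ∀ n → nonhooked n ≡ concat (applyUpTo (startingAt n ∘ suc) n)
  nonhooked-blocks n =
    cong concat (trans (cong (map _) (map-upTo suc n))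
                (trans (map-applyUpTo suc _ n) (applyUpTo-cong block n)))
    where
    block : ∀ i → map (interval n (suc i)) (map (suc i +_) (upTo (suc n ∸ suc i))) ≡ startingAt n (suc i)
    block i = trans (cong (map _) (map-upTo _ _)) (map-applyUpTo _ _ _)

  startingAt-first : ∀ m → startingAt (suc m) 1 ≡ map (1 ∷_) (initials m)
  startingAt-first m = begin
    startingAt (suc m) 1                           ≡⟨ applyUpTo-cong (interval-suc m 0) (suc m) ⟩
    applyUpTo ((1 ∷_) ∘ interval m 0) (suc m)      ≡⟨ sym (map-applyUpTo (interval m 0) (1 ∷_) (suc m)) ⟩
    map (1 ∷_) (applyUpTo (interval m 0) (suc m))  ≡⟨ cong (map (1 ∷_)) (initials-tabulate m) ⟩
    map (1 ∷_) (initials m)                        ∎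

  startingAt-later : ∀ m i → startingAt (suc m) (suc (suc i)) ≡ map (0 ∷_) (startingAt m (suc i))
  startingAt-later m i =
    trans (applyUpTo-cong (λ t → interval-suc m (suc i) (suc (i + t))) (suc m ∸ suc i))
          (sym (map-applyUpTo _ (0 ∷_) _))

  nonhooked-suc : ∀ m → nonhooked (suc m) ≡ map (1 ∷_) (initials m) ++ map (0 ∷_) (nonhooked m)
  nonhooked-suc m = begin
    nonhooked (suc m)
      ≡⟨ nonhooked-blocks (suc m) ⟩
    startingAt (suc m) 1 ++ concat (applyUpTo (startingAt (suc m) ∘ suc ∘ suc) m)
      ≡⟨ cong₂ _++_ (startingAt-first m) (cong concat (applyUpTo-cong (startingAt-later m) m)) ⟩
    map (1 ∷_) (initials m) ++ concat (applyUpTo (map (0 ∷_) ∘ startingAt m ∘ suc) m)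
      ≡⟨ cong (λ L → map (1 ∷_) (initials m) ++ concat L) (sym (map-applyUpTo _ (map (0 ∷_)) m)) ⟩
    map (1 ∷_) (initials m) ++ concat (map (map (0 ∷_)) (applyUpTo (startingAt m ∘ suc) m))
      ≡⟨ cong (map (1 ∷_) (initials m) ++_) (concat-map (applyUpTo (startingAt m ∘ suc) m)) ⟩
    map (1 ∷_) (initials m) ++ map (0 ∷_) (concat (applyUpTo (startingAt m ∘ suc) m))
      ≡⟨ cong (λ L → map (1 ∷_) (initials m) ++ map (0 ∷_) L) (sym (nonhooked-blocks m)) ⟩
    map (1 ∷_) (initials m) ++ map (0 ∷_) (nonhooked m) ∎

  nonhooked≡intervals : ∀ n → nonhooked n ≡ intervals n
  nonhooked≡intervals zero    = refl
  nonhooked≡intervals (suc m) =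
    trans (nonhooked-suc m) (cong (λ L → map (1 ∷_) (initials m) ++ map (0 ∷_) L) (nonhooked≡intervals m))

-- With roots
-- map (1 ∷_) X ++ map (0 ∷_) Y, a target with first coordinate 0, 1 or 2 is met by
-- no, one or two roots from X, and the rest is a partition by roots from Y.
module FirstCoordinate where

  open MultisetCount
  open NonhookedRoots using (initials)
  open import Data.Nat using (ℕ; zero; suc; _+_)
  open import Data.Bool using (true; if_then_else_)
  open import Data.Bool.Properties using (if-eta)
  open import Data.List using (List; []; _∷_; _++_; map; length; replicate)
  open import Data.Nat.Properties using (suc-injective)
  open import Function using (_∘_)
  open import Relation.Binary.PropositionalEquality

  fitSum : List (List ℕ) → (List ℕ → ℕ) → List ℕ → ℕ
  fitSum []      Φ w = 0
  fitSum (x ∷ X) Φ w = (if x ≼ w then Φ (w ⊝ x) else 0) + fitSum X Φ w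

  fitPairSum : List (List ℕ) → (List ℕ → ℕ) → List ℕ → ℕ
  fitPairSum []      Φ w = 0
  fitPairSum (x ∷ X) Φ w = (if x ≼ w then fitSum (x ∷ X) Φ (w ⊝ x) else 0) + fitPairSum X Φ w

  fitSum-cong : ∀ X {Φ Ψ : List ℕ → ℕ} → (∀ z → Φ z ≡ Ψ z) → ∀ w → fitSum X Φ w ≡ fitSum X Ψ w
  fitSum-cong []      Φ≗Ψ w = refl
  fitSum-cong (x ∷ X) Φ≗Ψ w = cong₂ _+_ (cong (λ n → if x ≼ w then n else 0) (Φ≗Ψ (w ⊝ x)))
                                         (fitSum-cong X Φ≗Ψ w)

  fitPairSum-cong : ∀ X {Φ Ψ : List ℕ → ℕ} → (∀ z → Φ z ≡ Ψ z) → ∀ w → fitPairSum X Φ w ≡ fitPairSum X Ψ w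
  fitPairSum-cong []      Φ≗Ψ w = refl
  fitPairSum-cong (x ∷ X) Φ≗Ψ w = cong₂ _+_ (cong (λ n → if x ≼ w then n else 0) (fitSum-cong (x ∷ X) Φ≗Ψ (w ⊝ x)))
                                             (fitPairSum-cong X Φ≗Ψ w)

  count-shifted : ∀ k Y u → count k (map (0 ∷_) Y) (0 ∷ u) ≡ count k Y u
  count-shifted zero    Y       u = refl
  count-shifted (suc k) []      u = refl
  count-shifted (suc k) (y ∷ Y) u = cong₂ _+_ (cong (λ n → if y ≼ u then n else 0) (count-shifted k (y ∷ Y) (u ⊝ y)))
                                               (count-shifted (suc k) Y u)

  count-shifted-miss : ∀ k Y a u → count k (map (0 ∷_) Y) (suc a ∷ u) ≡ 0
  count-shifted-miss zero    Y       a u = refl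
  count-shifted-miss (suc k) []      a u = refl
  count-shifted-miss (suc k) (y ∷ Y) a u = cong₂ _+_
    (trans (cong (λ n → if y ≼ u then n else 0) (count-shifted-miss k (y ∷ Y) a (u ⊝ y))) (if-eta (y ≼ u)))
    (count-shifted-miss (suc k) Y a u)

  count-front-0 : ∀ k X Y u → count k (map (1 ∷_) X ++ map (0 ∷_) Y) (0 ∷ u) ≡ count k Y u
  count-front-0 zero    X       Y u = refl
  count-front-0 (suc k) []      Y u = count-shifted (suc k) Y u
  count-front-0 (suc k) (x ∷ X) Y u = count-front-0 (suc k) X Y u

  count-front-1 : ∀ k X Y u → count (suc k) (map (1 ∷_) X ++ map (0 ∷_) Y) (1 ∷ u) ≡ fitSum X (count k Y) u
  count-front-1 k []      Y u = count-shifted-miss (suc k) Y 0 u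
  count-front-1 k (x ∷ X) Y u = cong₂ _+_ (cong (λ n → if x ≼ u then n else 0) (count-front-0 k (x ∷ X) Y (u ⊝ x)))
                                           (count-front-1 k X Y u)

  count-front-2 : ∀ k X Y u → count (suc (suc k)) (map (1 ∷_) X ++ map (0 ∷_) Y) (2 ∷ u) ≡ fitPairSum X (count k Y) u
  count-front-2 k []      Y u = count-shifted-miss (suc (suc k)) Y 1 u
  count-front-2 k (x ∷ X) Y u = cong₂ _+_ (cong (λ n → if x ≼ u then n else 0) (count-front-1 k (x ∷ X) Y (u ⊝ x)))
                                           (count-front-2 k X Y u)

  count-front-2-single : ∀ X Y u → count 1 (map (1 ∷_) X ++ map (0 ∷_) Y) (2 ∷ u) ≡ 0
  count-front-2-single []      Y u = count-shifted-miss 1 Y 1 u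
  count-front-2-single (x ∷ X) Y u =
    trans (cong (_+ count 1 (map (1 ∷_) X ++ map (0 ∷_) Y) (2 ∷ u)) (if-eta (x ≼ u)))
          (count-front-2-single X Y u)

  fitSum-ones : ∀ X Φ v w → fitSum (map (1 ∷_) X) Φ (suc v ∷ w) ≡ fitSum X (Φ ∘ (v ∷_)) w
  fitSum-ones []      Φ v w = refl
  fitSum-ones (x ∷ X) Φ v w = cong (_ +_) (fitSum-ones X Φ v w)

  fitPairSum-ones : ∀ X Φ w → fitPairSum (map (1 ∷_) X) Φ (2 ∷ w) ≡ fitPairSum X (Φ ∘ (0 ∷_)) w
  fitPairSum-ones []      Φ w = refl
  fitPairSum-ones (x ∷ X) Φ w = cong₂ _+_ (cong (λ n → if x ≼ w then n else 0) (fitSum-ones (x ∷ X) Φ 0 (w ⊝ x)))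
                                           (fitPairSum-ones X Φ w)

  zeros-≼ : ∀ n w → length w ≡ n → replicate n 0 ≼ w ≡ true
  zeros-≼ zero    w       _   = refl
  zeros-≼ (suc n) (_ ∷ w) len = zeros-≼ n w (suc-injective len)

  ⊝-zeros : ∀ n w → w ⊝ replicate n 0 ≡ w
  ⊝-zeros zero    []      = refl
  ⊝-zeros zero    (_ ∷ _) = refl
  ⊝-zeros (suc n) []      = refl
  ⊝-zeros (suc n) (t ∷ w) = cong (t ∷_) (⊝-zeros n w)

  -- An initial segment is either the zero vector or 1 followed by an initial segment.
  fitSum-initials : ∀ n Φ v w → length w ≡ n →
                    fitSum (initials (suc n)) Φ (suc v ∷ w) ≡ Φ (suc v ∷ w) + fitSum (initials n) (Φ ∘ (v ∷_)) w
  fitSum-initials n Φ v w len = cong₂ _+_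
    (trans (cong (λ b → if b then Φ ((suc v ∷ w) ⊝ replicate (suc n) 0) else 0) (zeros-≼ n w len))
           (cong Φ (⊝-zeros (suc n) (suc v ∷ w))))
    (fitSum-ones (initials n) Φ v w)

  fitPairSum-initials : ∀ n Φ w → length w ≡ n →
                        fitPairSum (initials (suc n)) Φ (2 ∷ w)
                          ≡ fitSum (initials (suc n)) Φ (2 ∷ w) + fitPairSum (initials n) (Φ ∘ (0 ∷_)) w
  fitPairSum-initials n Φ w len = cong₂ _+_
    (trans (cong (λ b → if b then fitSum (initials (suc n)) Φ ((2 ∷ w) ⊝ replicate (suc n) 0) else 0) (zeros-≼ n w len))
           (cong (fitSum (initials (suc n)) Φ) (⊝-zeros (suc n) (2 ∷ w))))
    (fitPairSum-ones (initials n) Φ w)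

-- Multiplication
-- by q is a shift, a polynomial p acts by p ∙ f = Σᵢ pᵢ qⁱ f, and the Cauchy
-- product in the definition of ⊛ is this action.
module QSeries where

  open import Data.Nat using (ℕ; zero; suc; _∸_)
  import Data.Nat as ℕ
  import Data.Nat.Properties as ℕ
  open import Data.Integer using (ℤ; +_; _+_; _*_)
  open import Data.Integer.Properties using (+-identityʳ; +-assoc; +-comm; *-zeroʳ; +-commutativeSemigroup)
  open import Algebra.Properties.CommutativeSemigroup +-commutativeSemigroup using (interchange)
  open import Data.List using (List; []; _∷_)
  open import Function using (_∘_)
  open import Relation.Binary.PropositionalEquality
  open ≡-Reasoning

  QSeries : Set
  QSeries = ℕ → ℤ

  0ₛ : QSeries
  0ₛ _ = + 0

  infixl 6 _⊕_
  _⊕_ : QSeries → QSeries → QSeries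
  (f ⊕ g) k = f k + g k

  infixr 7 _·_
  _·_ : ℤ → QSeries → QSeries
  (a · f) k = a * f k

  infixr 8 q*_
  q*_ : QSeries → QSeries
  (q* f) zero    = + 0
  (q* f) (suc k) = f k

  infixr 8 1+q*_
  1+q*_ : QSeries → QSeries
  1+q* f = f ⊕ q* f

  ⊕-cong : ∀ {f f′ g g′} → f ≗ f′ → g ≗ g′ → f ⊕ g ≗ f′ ⊕ g′
  ⊕-cong f≗f′ g≗g′ k = cong₂ _+_ (f≗f′ k) (g≗g′ k)

  ⊕-congʳ : ∀ f {g g′} → g ≗ g′ → f ⊕ g ≗ f ⊕ g′
  ⊕-congʳ f = ⊕-cong {f = f} (λ _ → refl)

  ⊕-comm : ∀ f g → f ⊕ g ≗ g ⊕ f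
  ⊕-comm f g k = +-comm (f k) (g k)

  q*-cong : ∀ {f g} → f ≗ g → q* f ≗ q* g
  q*-cong f≗g zero    = refl
  q*-cong f≗g (suc k) = f≗g k

  q*-⊕ : ∀ f g → q* (f ⊕ g) ≗ q* f ⊕ q* g
  q*-⊕ f g zero    = refl
  q*-⊕ f g (suc k) = refl

  shifted : ∀ {f g h} → f ≗ g ⊕ h → q* f ≗ q* g ⊕ q* h
  shifted {g = g} {h} f≗g⊕h k = trans (q*-cong f≗g⊕h k) (q*-⊕ g h k)

  1+q*-cong : ∀ {f g} → f ≗ g → 1+q* f ≗ 1+q* g
  1+q*-cong f≗g = ⊕-cong f≗g (q*-cong f≗g)

  1+q*-⊕ : ∀ f g → 1+q* (f ⊕ g) ≗ 1+q* f ⊕ 1+q* g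
  1+q*-⊕ f g k = trans (cong (λ x → (f k + g k) + x) (q*-⊕ f g k)) (interchange (f k) (g k) ((q* f) k) ((q* g) k))

  infixr 7 _∙_
  _∙_ : List ℤ → QSeries → QSeries
  []      ∙ f = 0ₛ
  (a ∷ p) ∙ f = a · f ⊕ p ∙ q* f

  ∙-cong : ∀ p {f g} → f ≗ g → p ∙ f ≗ p ∙ g
  ∙-cong []      f≗g k = refl
  ∙-cong (a ∷ p) f≗g k = cong₂ _+_ (cong (a *_) (f≗g k)) (∙-cong p (q*-cong f≗g) k)

  ∙-q* : ∀ p f → p ∙ q* f ≗ q* (p ∙ f)
  ∙-q* []      f zero    = refl
  ∙-q* []      f (suc k) = refl
  ∙-q* (a ∷ p) f zero    = cong₂ _+_ (*-zeroʳ a) (∙-q* p (q* f) zero)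
  ∙-q* (a ∷ p) f (suc k) = cong (λ x → a * f k + x) (∙-q* p (q* f) (suc k))

  coeffs : List ℤ → ℕ → ℤ
  coeffs = nth (+ 0)

  _⋆_ : (ℕ → ℤ) → QSeries → QSeries
  (d ⋆ f) k = sumTo k (λ j → d j * f (k ∸ j))

  sumTo-peel : ∀ r g → sumTo (suc r) g ≡ g 0 + sumTo r (g ∘ suc)
  sumTo-peel zero    g = refl
  sumTo-peel (suc r) g = trans (cong (_+ g (suc (suc r))) (sumTo-peel r g)) (+-assoc (g 0) _ _)

  sumTo-zero : ∀ r → sumTo r (λ _ → + 0) ≡ + 0
  sumTo-zero zero    = refl
  sumTo-zero (suc r) = cong (λ x → x + + 0) (sumTo-zero r)

  sumTo-tail : ∀ n g → (∀ t → g (suc (n ℕ.+ t)) ≡ + 0) → ∀ t → sumTo (n ℕ.+ t) g ≡ sumTo n g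
  sumTo-tail n g vanish zero    = cong (λ m → sumTo m g) (ℕ.+-identityʳ n)
  sumTo-tail n g vanish (suc t) = begin
    sumTo (n ℕ.+ suc t) g                   ≡⟨ cong (λ m → sumTo m g) (ℕ.+-suc n t) ⟩
    sumTo (n ℕ.+ t) g + g (suc (n ℕ.+ t))   ≡⟨ cong₂ _+_ (sumTo-tail n g vanish t) (vanish t) ⟩
    sumTo n g + + 0                         ≡⟨ +-identityʳ _ ⟩
    sumTo n g                               ∎

  ⋆-coeffs : ∀ p f → coeffs p ⋆ f ≗ p ∙ f
  ⋆-coeffs []      f k       = sumTo-zero k
  ⋆-coeffs (a ∷ p) f zero    = sym (trans (cong (λ x → a * f 0 + x) (∙-q* p f zero)) (+-identityʳ _))
  ⋆-coeffs (a ∷ p) f (suc k) = begin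
    sumTo (suc k) (λ j → coeffs (a ∷ p) j * f (suc k ∸ j)) ≡⟨ sumTo-peel k _ ⟩
    a * f (suc k) + (coeffs p ⋆ f) k                       ≡⟨ cong (λ x → a * f (suc k) + x) (⋆-coeffs p f k) ⟩
    a * f (suc k) + (p ∙ f) k                              ≡⟨ cong (λ x → a * f (suc k) + x) (∙-q* p f (suc k)) ⟨
    ((a ∷ p) ∙ f) (suc k)                                  ∎

  poly₃-⊛ : ∀ p₀ p₁ p₂ (F : Series) r k →
            (poly (p₀ ∷ p₁ ∷ p₂ ∷ []) ⊛ F) (2 ℕ.+ r) k ≡ (p₀ ∙ F (2 ℕ.+ r)) k + (p₁ ∙ F (1 ℕ.+ r)) k + (p₂ ∙ F r) k
  poly₃-⊛ p₀ p₁ p₂ F r k = trans (sumTo-tail 2 _ (λ _ → sumTo-zero k) r)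
    (cong₂ _+_ (cong₂ _+_ (⋆-coeffs p₀ (F (2 ℕ.+ r)) k) (⋆-coeffs p₁ (F (1 ℕ.+ r)) k)) (⋆-coeffs p₂ (F r) k))

-- Partition series of the targets 1^b 2^c (b ones followed by c twos), counted by
-- nonhooked roots of B_{b+c} and graded by the number of parts.
module PartitionSeries where

  open MultisetCount using (count)
  open NonhookedRoots using (initials; intervals)
  open FirstCoordinate
  open QSeries
  open import Data.Nat using (ℕ; zero; suc; _+_)
  open import Data.Nat.Properties using (+-suc; +-identityʳ)
  open import Data.Integer using (ℤ; +_)
  open import Data.List using (List; _∷_; _++_; length; replicate)
  open import Data.List.Properties using (length-++; length-replicate)
  open import Relation.Binary.PropositionalEquality using (_≡_; _≗_; refl; cong; cong₂; trans; _→-setoid_)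
  open import Relation.Binary.Reasoning.Setoid (ℕ →-setoid ℤ)

  target : ℕ → ℕ → List ℕ
  target b c = replicate b 1 ++ replicate c 2

  length-target : ∀ b c → length (target b c) ≡ b + c
  length-target b c = trans (length-++ (replicate b 1)) (cong₂ _+_ (length-replicate b) (length-replicate c))

  ones-snoc : ∀ i (z : List ℕ) → replicate i 1 ++ 1 ∷ z ≡ replicate (suc i) 1 ++ z
  ones-snoc zero    z = refl
  ones-snoc (suc i) z = cong (1 ∷_) (ones-snoc i z)

  cover : ℕ → ℕ → QSeries
  cover b c k = + count k (intervals (b + c)) (target b c)

  coverFront : ℕ → ℕ → QSeries
  coverFront b c k = + fitSum (initials (b + c)) (count k (intervals (b + c))) (target b c)

  coverTail : ℕ → ℕ → QSeries
  coverTail i c k = + fitSum (initials c) (λ w → count k (intervals (i + c)) (replicate i 1 ++ w)) (replicate c 2)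

  coverPair : ℕ → QSeries
  coverPair c k = + fitPairSum (initials c) (count k (intervals c)) (replicate c 2)

  -- A leading 1 is covered by exactly one root, namely 1 followed by an initial segment.
  cover-front : ∀ b c → cover (suc b) c ≗ q* coverFront b c
  cover-front b c zero    = refl
  cover-front b c (suc k) = cong +_ (count-front-1 k (initials (b + c)) (intervals (b + c)) (target b c))

  -- That initial segment is empty, or it also covers the next coordinate.
  coverFront-suc : ∀ b c → coverFront (suc b) c ≗ cover (suc b) c ⊕ coverFront b c
  coverFront-suc b c k = cong +_ (trans (fitSum-initials (b + c) _ 0 (target b c) (length-target b c))
    (cong (λ n → count k (intervals (suc b + c)) (target (suc b) c) + n)
          (fitSum-cong (initials (b + c)) (count-front-0 k (initials (b + c)) (intervals (b + c))) (target b c))))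

  -- The initial segment removed from 2^(c+1) is empty, or it turns the first 2 into a 1.
  coverTail-suc : ∀ i c → coverTail i (suc c) ≗ cover i (suc c) ⊕ coverTail (suc i) c
  coverTail-suc i c k = cong +_ (trans (fitSum-initials c _ 1 (replicate c 2) (length-replicate c))
    (cong (λ n → count k (intervals (i + suc c)) (target i (suc c)) + n) (fitSum-cong (initials c) one-more-one (replicate c 2))))
    where
    one-more-one : ∀ z → count k (intervals (i + suc c)) (replicate i 1 ++ 1 ∷ z)
                       ≡ count k (intervals (suc i + c)) (replicate (suc i) 1 ++ z)
    one-more-one z rewrite +-suc i c | ones-snoc i z = refl

  coverTail-zero : ∀ i → coverTail i 0 ≗ cover i 0
  coverTail-zero i k = cong +_ (+-identityʳ _)

  -- A leading 2 is covered by exactly two roots, both 1 followed by an initial segment.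
  cover-twos : ∀ c → cover 0 (suc c) ≗ q* q* coverPair c
  cover-twos c zero          = refl
  cover-twos c (suc zero)    = cong +_ (count-front-2-single (initials c) (intervals c) (replicate c 2))
  cover-twos c (suc (suc k)) = cong +_ (count-front-2 k (initials c) (intervals c) (replicate c 2))

  -- The first of the two segments removed from 2^(c+1) is empty, or both are not.
  coverPair-suc : ∀ c → coverPair (suc c) ≗ coverTail 0 (suc c) ⊕ coverPair c
  coverPair-suc c k = cong +_ (trans (fitPairSum-initials c _ (replicate c 2) (length-replicate c))
    (cong (λ n → fitSum (initials (suc c)) (count k (intervals (suc c))) (replicate (suc c) 2) + n)
          (fitPairSum-cong (initials c) (count-front-0 k (initials c) (intervals c)) (replicate c 2))))

  cover-double : ∀ b c → cover (2 + b) c ≗ 1+q* cover (1 + b) c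
  cover-double b c = begin
    cover (2 + b) c                                 ≈⟨ cover-front (suc b) c ⟩
    q* coverFront (1 + b) c                         ≈⟨ q*-cong (coverFront-suc b c) ⟩
    q* (cover (1 + b) c ⊕ coverFront b c)           ≈⟨ q*-⊕ (cover (1 + b) c) (coverFront b c) ⟩
    q* cover (1 + b) c ⊕ q* coverFront b c          ≈⟨ ⊕-congʳ (q* cover (1 + b) c) (cover-front b c) ⟨
    q* cover (1 + b) c ⊕ cover (1 + b) c            ≈⟨ ⊕-comm (q* cover (1 + b) c) (cover (1 + b) c) ⟩
    1+q* cover (1 + b) c                            ∎

  coverTail-double : ∀ i c → coverTail (2 + i) c ≗ 1+q* coverTail (1 + i) c
  coverTail-double i zero = begin
    coverTail (2 + i) 0                             ≈⟨ coverTail-zero (2 + i) ⟩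
    cover (2 + i) 0                                 ≈⟨ cover-double i 0 ⟩
    1+q* cover (1 + i) 0                            ≈⟨ 1+q*-cong (coverTail-zero (1 + i)) ⟨
    1+q* coverTail (1 + i) 0                        ∎
  coverTail-double i (suc c) = begin
    coverTail (2 + i) (suc c)                       ≈⟨ coverTail-suc (2 + i) c ⟩
    cover (2 + i) (suc c) ⊕ coverTail (3 + i) c     ≈⟨ ⊕-cong (cover-double i (suc c)) (coverTail-double (suc i) c) ⟩
    1+q* cover (1 + i) (suc c) ⊕ 1+q* coverTail (2 + i) c
                                                    ≈⟨ 1+q*-⊕ (cover (1 + i) (suc c)) (coverTail (2 + i) c) ⟨
    1+q* (cover (1 + i) (suc c) ⊕ coverTail (2 + i) c)
                                                    ≈⟨ 1+q*-cong (coverTail-suc (1 + i) c) ⟨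
    1+q* coverTail (1 + i) (suc c)                  ∎

  -- A c: partitions of the highest root 1 2^c of B_{c+1}; E c: partitions of 2^c; T c: auxiliary.
  A E T : ℕ → QSeries
  A c = cover 1 c
  E c = cover 0 c
  T c = coverTail 1 c

  -- The highest root 1 2^c: its 1 is covered by α₁ + ⋯ + αⱼ, leaving 2^c minus a segment.
  A-tail : ∀ c → A c ≗ q* coverTail 0 c
  A-tail = cover-front 0

  A-suc : ∀ c → A (suc c) ≗ q* E (suc c) ⊕ q* T c
  A-suc c = begin
    A (suc c)                 ≈⟨ A-tail (suc c) ⟩
    q* coverTail 0 (suc c)    ≈⟨ shifted (coverTail-suc 0 c) ⟩
    q* E (suc c) ⊕ q* T c     ∎

  T-suc : ∀ c → T (suc c) ≗ A (suc c) ⊕ 1+q* T c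
  T-suc c = begin
    T (suc c)                 ≈⟨ coverTail-suc 1 c ⟩
    A (suc c) ⊕ coverTail 2 c ≈⟨ ⊕-congʳ (A (suc c)) (coverTail-double 0 c) ⟩
    A (suc c) ⊕ 1+q* T c      ∎

  E-suc : ∀ c → E (2 + c) ≗ E (1 + c) ⊕ q* A (1 + c)
  E-suc c = begin
    E (2 + c)                                      ≈⟨ cover-twos (suc c) ⟩
    q* q* coverPair (1 + c)                        ≈⟨ q*-cong (shifted (coverPair-suc c)) ⟩
    q* (q* coverTail 0 (1 + c) ⊕ q* coverPair c)   ≈⟨ q*-⊕ (q* coverTail 0 (1 + c)) (q* coverPair c) ⟩
    q* q* coverTail 0 (1 + c) ⊕ q* q* coverPair c  ≈⟨ ⊕-cong (q*-cong (A-tail (1 + c))) (cover-twos c) ⟨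
    q* A (1 + c) ⊕ E (1 + c)                       ≈⟨ ⊕-comm (q* A (1 + c)) (E (1 + c)) ⟩
    E (1 + c) ⊕ q* A (1 + c)                       ∎

-- Eliminating E and T from the relations for A, E, T gives
--   A_{c+2} = (1+q)² A_{c+1} − q² E_{c+1}
-- and then the recurrence  A_{c+3} − (2+2q+q²) A_{c+2} + (1+2q+q²+q³) A_{c+1} = 0,
-- whose coefficient polynomials are the rows of the denominator.
module Recurrence where

  open QSeries
  open PartitionSeries using (A; E; T; A-suc; T-suc; E-suc)
  open import Data.Nat using (ℕ; suc)
  import Data.Nat as ℕ
  open import Data.Integer using (ℤ; +_; -[1+_]; _+_; _*_; _-_)
  open import Data.Integer.Tactic.RingSolver using (solve)
  open import Data.List using (List; []; _∷_)
  open import Relation.Binary.PropositionalEquality using (_≡_; refl; trans; cong)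

  row₀ row₁ row₂ : List ℤ
  row₀ = + 1 ∷ []
  row₁ = -[1+ 1 ] ∷ -[1+ 1 ] ∷ -[1+ 0 ] ∷ []
  row₂ = + 1 ∷ + 2 ∷ + 1 ∷ + 1 ∷ []

  A-step-algebra : ∀ {a₂ qe₂ qt₁ a₁ qa₁} qe₁ q²a₁ qt₀ q²t₀ q²e₁ →
    a₂ ≡ qe₂ + qt₁ → qe₂ ≡ qe₁ + q²a₁ → qt₁ ≡ qa₁ + (qt₀ + q²t₀) →
    a₁ ≡ qe₁ + qt₀ → qa₁ ≡ q²e₁ + q²t₀ →
    a₂ ≡ a₁ + + 2 * qa₁ + q²a₁ - q²e₁
  A-step-algebra qe₁ q²a₁ qt₀ q²t₀ q²e₁ refl refl refl refl refl =
    solve (qe₁ ∷ q²a₁ ∷ qt₀ ∷ q²t₀ ∷ q²e₁ ∷ [])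

  A-step : ∀ c k → A (2 ℕ.+ c) k ≡ A (1 ℕ.+ c) k + + 2 * (q* A (1 ℕ.+ c)) k + (q* q* A (1 ℕ.+ c)) k - (q* q* E (1 ℕ.+ c)) k
  A-step c k = A-step-algebra ((q* E₁) k) ((q* q* A₁) k) ((q* T c) k) ((q* q* T c) k) ((q* q* E₁) k)
    (A-suc (suc c) k) qE₂ qT₁ (A-suc c k) qA₁
    where
    A₁ E₁ : QSeries
    A₁ = A (1 ℕ.+ c)
    E₁ = E (1 ℕ.+ c)
    qE₂ : (q* E (2 ℕ.+ c)) k ≡ (q* E₁) k + (q* q* A₁) k
    qE₂ = shifted (E-suc c) k
    qT₁ : (q* T (1 ℕ.+ c)) k ≡ (q* A₁) k + ((q* T c) k + (q* q* T c) k)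
    qT₁ = trans (shifted (T-suc c) k) (cong (λ x → (q* A₁) k + x) (q*-⊕ (T c) (q* T c) k))
    qA₁ : (q* A₁) k ≡ (q* q* E₁) k + (q* q* T c) k
    qA₁ = shifted (A-suc c) k

  -- The elimination behind the recurrence: substitute A-step at c + 1 and at c,
  -- and q² times E-suc.  The goal is row₀ ∙ a₃ + row₁ ∙ a₂ + row₂ ∙ a₁ = 0 written out.
  recurrence-algebra : ∀ {a₃ q²e₂ a₂} qa₂ q²a₂ a₁ qa₁ q²a₁ q³a₁ q²e₁ →
    a₃ ≡ a₂ + + 2 * qa₂ + q²a₂ - q²e₂ → q²e₂ ≡ q²e₁ + q³a₁ → a₂ ≡ a₁ + + 2 * qa₁ + q²a₁ - q²e₁ →
    (+ 1 * a₃ + + 0)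
      + (-[1+ 1 ] * a₂ + (-[1+ 1 ] * qa₂ + (-[1+ 0 ] * q²a₂ + + 0)))
      + (+ 1 * a₁ + (+ 2 * qa₁ + (+ 1 * q²a₁ + (+ 1 * q³a₁ + + 0))))
      ≡ + 0
  recurrence-algebra qa₂ q²a₂ a₁ qa₁ q²a₁ q³a₁ q²e₁ refl refl refl =
    solve (qa₂ ∷ q²a₂ ∷ a₁ ∷ qa₁ ∷ q²a₁ ∷ q³a₁ ∷ q²e₁ ∷ [])

  recurrence : ∀ c k → (row₀ ∙ A (3 ℕ.+ c)) k + (row₁ ∙ A (2 ℕ.+ c)) k + (row₂ ∙ A (1 ℕ.+ c)) k ≡ + 0
  recurrence c k = recurrence-algebra
    ((q* A₂) k) ((q* q* A₂) k) (A₁ k) ((q* A₁) k) ((q* q* A₁) k) ((q* q* q* A₁) k) ((q* q* E (1 ℕ.+ c)) k)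
    (A-step (suc c) k) q²E₂ (A-step c k)
    where
    A₂ A₁ : QSeries
    A₂ = A (2 ℕ.+ c)
    A₁ = A (1 ℕ.+ c)
    q²E₂ : (q* q* E (2 ℕ.+ c)) k ≡ (q* q* E (1 ℕ.+ c)) k + (q* q* q* A₁) k
    q²E₂ = shifted (shifted (E-suc c)) k

module Coefficients where

  open MultisetCount using (count; sumsTo?; count-correct)
  open NonhookedRoots using (intervals; intervals-length; nonhooked≡intervals)
  open QSeries
  open PartitionSeries using (A)
  open Recurrence using (row₀; row₁; row₂; recurrence)
  open import Data.Nat using (ℕ; suc)
  import Data.Nat as ℕ
  open import Data.Integer using (+_; _+_)
  open import Data.List using (length; filter)
  open import Data.List.Properties using (length-replicate)
  open import Relation.Binary.PropositionalEquality
  open ≡-Reasoning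

  PNH≗A : ∀ c → PNHSeries (suc c) ≗ A c
  PNH≗A c k = cong +_ (begin
      dNH (suc c) k
    ≡⟨ cong (λ L → length (filter (sumsTo? (suc c) (highest (suc c))) (multisets k L))) (nonhooked≡intervals (suc c)) ⟩
      length (filter (sumsTo? (suc c) (highest (suc c))) (multisets k (intervals (suc c))))
    ≡⟨ count-correct (suc c) k (intervals (suc c)) (highest (suc c)) (intervals-length (suc c))
                     (cong suc (length-replicate c)) ⟩
      count k (intervals (suc c)) (highest (suc c)) ∎)

  product-A : ∀ r k → (denominator ⊛ PNHSeries) (3 ℕ.+ r) k
                       ≡ (row₀ ∙ A (2 ℕ.+ r)) k + (row₁ ∙ A (1 ℕ.+ r)) k + (row₂ ∙ A r) k
  product-A r k = trans (poly₃-⊛ row₀ row₁ row₂ PNHSeries (suc r) k)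
    (cong₂ _+_ (cong₂ _+_ (∙-cong row₀ (PNH≗A (2 ℕ.+ r)) k) (∙-cong row₁ (PNH≗A (1 ℕ.+ r)) k))
               (∙-cong row₂ (PNH≗A r) k))

  degree-≥4 : ∀ c k → (denominator ⊛ PNHSeries) (4 ℕ.+ c) k ≡ numerator (4 ℕ.+ c) k
  degree-≥4 c k = trans (product-A (suc c) k) (recurrence c k)

  -- x-degrees 0 to 3 are finite computations: a vector has partitions into at most as
  -- many parts as its coordinate sum, so A 0, A 1, A 2 vanish beyond q-degree 1, 3, 5
  -- (definitionally, by evaluating count), and only the first coefficients are compared.
  degree-0 : ∀ k → (denominator ⊛ PNHSeries) 0 k ≡ numerator 0 k
  degree-0 = ⋆-coeffs row₀ (PNHSeries 0)

  degree-1 : ∀ k → (denominator ⊛ PNHSeries) 1 k ≡ numerator 1 k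
  degree-1 k = trans (cong₂ _+_ (trans (⋆-coeffs row₀ (PNHSeries 1) k) (∙-cong row₀ (PNH≗A 0) k))
                                (⋆-coeffs row₁ (PNHSeries 0) k))
                     (compare k)
    where
    compare : ∀ k → (row₀ ∙ A 0) k + (row₁ ∙ PNHSeries 0) k ≡ numerator 1 k
    compare 0             = refl
    compare 1             = refl
    compare (suc (suc k)) = refl

  degree-2 : ∀ k → (denominator ⊛ PNHSeries) 2 k ≡ numerator 2 k
  degree-2 k = trans (poly₃-⊛ row₀ row₁ row₂ PNHSeries 0 k)
                     (trans (cong (λ x → x + (row₂ ∙ PNHSeries 0) k)
                                  (cong₂ _+_ (∙-cong row₀ (PNH≗A 1) k) (∙-cong row₁ (PNH≗A 0) k)))
                            (compare k))
    where
    compare : ∀ k → (row₀ ∙ A 1) k + (row₁ ∙ A 0) k + (row₂ ∙ PNHSeries 0) k ≡ numerator 2 k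
    compare 0                         = refl
    compare 1                         = refl
    compare 2                         = refl
    compare 3                         = refl
    compare (suc (suc (suc (suc k)))) = refl

  degree-3 : ∀ k → (denominator ⊛ PNHSeries) 3 k ≡ numerator 3 k
  degree-3 k = trans (product-A 0 k) (compare k)
    where
    compare : ∀ k → (row₀ ∙ A 2) k + (row₁ ∙ A 1) k + (row₂ ∙ A 0) k ≡ numerator 3 k
    compare 0                                     = refl
    compare 1                                     = refl
    compare 2                                     = refl
    compare 3                                     = refl
    compare 4                                     = refl
    compare 5                                     = refl
    compare (suc (suc (suc (suc (suc (suc k)))))) = refl

proposition3p6 : ∀ (r k : ℕ) → (denominator ⊛ PNHSeries) r k ≡ numerator r k
proposition3p6 0                             = Coefficients.degree-0
proposition3p6 1                             = Coefficients.degree-1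
proposition3p6 2                             = Coefficients.degree-2
proposition3p6 3                             = Coefficients.degree-3
proposition3p6 (suc (suc (suc (suc c)))) = Coefficients.degree-≥4 c
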